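{- Let $G$ be a finite graph such that ${\rm Iso}(G)\neq\emptyset$ or ${\rm Iso}(\overline{G})\neq\emptyset$. Then $$p(G)\geq\lceil\log_2(\max(|{\rm Iso}(G)|,|{\rm Iso}(\overline{G})|)+1)\rceil.$$
   Context: Graphs are finite, simple, undirected; $\overline{G}$ is the complement of $G$, and ${\rm Iso}(G)$ is the set of isolated vertices of $G$. A module of $G$ is a set $M\subseteq V(G)$ such that each vertex outside $M$ is adjacent to all or none of $M$; trivial modules are $\emptyset$, $V(G)$, singletons; $G$ is prime if $|V(G)|\geq 4$ and all its modules are trivial. An extension of $G$ is a graph $H$ with $V(H)\supseteq V(G)$ and $H[V(G)]=G$; a $p$-extension additionally has $|V(H)\setminus V(G)|=p$. The prime bound $p(G)$ is the least $p$ such that $G$ admits a prime $p$-extension. -}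

module Defs where

open import Data.Nat using (ℕ; _+_; _≤_; _⊔_)
open import Data.Bool using (Bool; true; false; T; not)
open import Data.Fin using (Fin; _≟_; _↑ˡ_)
open import Data.Fin.Properties using (all?)
open import Data.List using (List; length; filter)
open import Data.Product using (_×_; Σ; ∃)
open import Data.Sum using (_⊎_)
open import Data.Bool.Properties using (T?)
open import Relation.Nullary using (¬_; Dec)
open import Relation.Nullary.Decidable using (¬?)
open import Relation.Binary.PropositionalEquality using (_≡_; _≢_)
open import Data.List using (allFin) public

record Graph (n : ℕ) : Set where
  field
    adj   : Fin n → Fin n → Bool
    sym   : ∀ u v → adj u v ≡ adj v u
    irref : ∀ v → adj v v ≡ false
open Graph public

IsIsolated : ∀ {n} → Graph n → Fin n → Set
IsIsolated G v = ∀ u → ¬ T (adj G v u)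

isIsolated? : ∀ {n} (G : Graph n) (v : Fin n) → Dec (IsIsolated G v)
isIsolated? G v = all? (λ u → ¬? (T? (adj G v u)))

numIso : ∀ {n} → Graph n → ℕ
numIso {n} G = length (filter (isIsolated? G) (allFin n))

-- Isolated vertices of the complement of G: v adjacent (in G) to every u ≠ v.
IsIsolatedCompl : ∀ {n} → Graph n → Fin n → Set
IsIsolatedCompl G v = ∀ u → ¬ (u ≡ v) → T (adj G v u)

isIsolatedCompl? : ∀ {n} (G : Graph n) (v : Fin n) → Dec (IsIsolatedCompl G v)
isIsolatedCompl? G v = all? (λ u → decImp u)
  where
  open import Relation.Nullary.Decidable using (_→-dec_)
  decImp : ∀ u → Dec (¬ (u ≡ v) → T (adj G v u))
  decImp u = ¬? (u ≟ v) →-dec T? (adj G v u)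

numIsoCompl : ∀ {n} → Graph n → ℕ
numIsoCompl {n} G = length (filter (isIsolatedCompl? G) (allFin n))

IsModule : ∀ {m} → Graph m → (Fin m → Bool) → Set
IsModule H M = ∀ x → ¬ T (M x) →
  ((∀ y → T (M y) → T (adj H x y)) ⊎ (∀ y → T (M y) → ¬ T (adj H x y)))

IsTrivial : ∀ {m} → (Fin m → Bool) → Set
IsTrivial M = (∀ x → ¬ T (M x)) ⊎ (∀ x → T (M x)) ⊎
              (∃ λ v → ∀ x → T (M x) → x ≡ v)

IsPrime : ∀ {m} → Graph m → Set
IsPrime {m} H = 4 ≤ m × (∀ M → IsModule H M → IsTrivial M)

IsExtension : ∀ {n} p → Graph (n + p) → Graph n → Set
IsExtension {n} p H G = ∀ u v → adj H (u ↑ˡ p) (v ↑ˡ p) ≡ adj G u v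

-- Let b be true or false, and call a vertex of G b-uniform if it is adjacent (b = true) or
-- non-adjacent (b = false) to every other vertex of G; these are the isolated vertices of the
-- complement of G, respectively of G. In a prime p-extension H, record for each vertex u of G its
-- signature, the adjacency of u to the p new vertices. Two b-uniform vertices with the same
-- signature would form a module {u, v} of H, and a b-uniform vertex whose signature is constantly
-- b would be b-uniform in H, making V(H) ∖ {u} a module. So the signatures of the b-uniform
-- vertices are pairwise distinct and avoid the constant b: there are at most 2^p - 1 of them.
module Submission where

open import Defs
open import Level using (0ℓ)
open import Data.Nat using (ℕ; suc; _+_; _≤_; _<_; _>_; _⊔_; _^_; s≤s)
open import Data.Nat.Properties using (+-comm; ⊔-lub; <⇒≤; module ≤-Reasoning)
open import Data.Nat.Logarithm using (⌈log₂_⌉; ⌈log₂⌉-mono-≤; ⌈log₂2^n⌉≡n)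
open import Data.Fin using (Fin; zero; suc; _↑ˡ_; _↑ʳ_; splitAt; funToFin; finToFun)
open import Data.Fin.Properties
  using (_≟_; join-splitAt; ↑ˡ-injective; injective⇒≤; finToFun-funToFin; 2↔Bool)
open import Data.Bool using (Bool; true; false; T)
open import Data.Bool.Properties using (T-≡; ¬-not)
open import Data.Sum using (_⊎_; inj₁; inj₂; [_,_])
open import Data.Product using (_×_; _,_; proj₁; proj₂; ∃)
open import Data.List using (List; _∷_; length; filter; lookup)
open import Data.List.Membership.Propositional using (_∈_)
open import Data.List.Membership.Propositional.Properties using (∈-lookup; ∈-filter⁻)
open import Data.List.Relation.Unary.All as All using ()
open import Data.List.Relation.Unary.AllPairs using (_∷_)
open import Data.List.Relation.Unary.Unique.Propositional using (Unique)
open import Data.List.Relation.Unary.Unique.Propositional.Properties using (allFin⁺; filter⁺)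
open import Function using (_∘_; const)
open import Function.Bundles using (Inverse; Equivalence)
open import Function.Definitions using (Injective)
open import Relation.Nullary using (¬_; yes; no; contradiction)
open import Relation.Nullary.Decidable
  using (⌊_⌋; toWitness; fromWitness; decidable-stable; ¬?; _⊎-dec_)
open import Relation.Unary using (Pred; Decidable)
open import Relation.Binary.PropositionalEquality
  using (_≡_; _≢_; _≗_; refl; trans; cong; subst; module ≡-Reasoning)
  renaming (sym to ≡-sym)

Uniform : ∀ {m} → Graph m → Bool → Fin m → Set
Uniform H c u = ∀ y → y ≢ u → adj H u y ≡ c

isolated⇒uniform : ∀ {n} (G : Graph n) {u} → IsIsolated G u → Uniform G false u
isolated⇒uniform G iso w _ = ¬-not (iso w ∘ Equivalence.from T-≡)

isolatedCompl⇒uniform : ∀ {n} (G : Graph n) {u} → IsIsolatedCompl G u → Uniform G true u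
isolatedCompl⇒uniform G iso w w≢u = Equivalence.to T-≡ (iso w w≢u)

fresh : ∀ {m} → 3 ≤ m → (a b : Fin m) → ∃ λ c → c ≢ a × c ≢ b
fresh (s≤s (s≤s (s≤s _))) zero          zero          = suc zero , (λ ()) , (λ ())
fresh (s≤s (s≤s (s≤s _))) zero          (suc zero)    = suc (suc zero) , (λ ()) , (λ ())
fresh (s≤s (s≤s (s≤s _))) zero          (suc (suc _)) = suc zero , (λ ()) , (λ ())
fresh (s≤s (s≤s (s≤s _))) (suc zero)    zero          = suc (suc zero) , (λ ()) , (λ ())
fresh (s≤s (s≤s (s≤s _))) (suc (suc _)) zero          = suc zero , (λ ()) , (λ ())
fresh (s≤s (s≤s (s≤s _))) (suc _)       (suc _)       = zero , (λ ()) , (λ ())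

module _ {m} (H : Graph m) where

  homogeneous⇒isModule : {P : Pred (Fin m) 0ℓ} (P? : Decidable P) →
    (∀ x → ¬ P x → ∃ λ c → ∀ y → P y → adj H x y ≡ c) →
    IsModule H (λ x → ⌊ P? x ⌋)
  homogeneous⇒isModule P? homogeneous x x∉M with homogeneous x (x∉M ∘ fromWitness)
  ... | true  , constant = inj₁ λ y y∈M →
    Equivalence.from T-≡ (constant y (toWitness y∈M))
  ... | false , constant = inj₂ λ y y∈M →
    subst T (constant y (toWitness y∈M))

  homogeneous⇒¬prime : {P : Pred (Fin m) 0ℓ} (P? : Decidable P) →
    (∀ x → ¬ P x → ∃ λ c → ∀ y → P y → adj H x y ≡ c) →
    ∀ {a b c} → P a → P b → a ≢ b → ¬ P c → ¬ IsPrime H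
  homogeneous⇒¬prime P? homogeneous {a} {b} {c} Pa Pb a≢b ¬Pc (_ , prime)
    with prime _ (homogeneous⇒isModule P? homogeneous)
  ... | inj₁ empty               = empty a (fromWitness Pa)
  ... | inj₂ (inj₁ full)         = ¬Pc (toWitness (full c))
  ... | inj₂ (inj₂ (_ , single)) =
    a≢b (trans (single a (fromWitness Pa)) (≡-sym (single b (fromWitness Pb))))

  prime⇒twins-equal : IsPrime H → ∀ {u v} →
    (∀ x → x ≢ u → x ≢ v → adj H x u ≡ adj H x v) → u ≡ v
  prime⇒twins-equal prime {u} {v} twins with u ≟ v
  ... | yes u≡v = u≡v
  ... | no  u≢v with fresh (<⇒≤ (proj₁ prime)) u v
  ... | _ , c≢u , c≢v = contradiction prime
    (homogeneous⇒¬prime (λ x → x ≟ u ⊎-dec x ≟ v) homogeneous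
      (inj₁ refl) (inj₂ refl) u≢v [ c≢u , c≢v ])
    where
    homogeneous : ∀ x → ¬ (x ≡ u ⊎ x ≡ v) → ∃ λ c → ∀ y → y ≡ u ⊎ y ≡ v → adj H x y ≡ c
    homogeneous x x∉uv = adj H x u , λ where
      _ (inj₁ refl) → refl
      _ (inj₂ refl) → ≡-sym (twins x (x∉uv ∘ inj₁) (x∉uv ∘ inj₂))

  prime⇒¬uniform : IsPrime H → ∀ {c u} → ¬ Uniform H c u
  prime⇒¬uniform prime {c} {u} uniform
    with fresh (<⇒≤ (proj₁ prime)) u u
  ... | a , a≢u , _ with fresh (<⇒≤ (proj₁ prime)) u a
  ... | b , b≢u , b≢a = homogeneous⇒¬prime (λ x → ¬? (x ≟ u)) homogeneous
    a≢u b≢u (b≢a ∘ ≡-sym) (λ u≢u → u≢u refl) prime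
    where
    homogeneous : ∀ x → ¬ (x ≢ u) → ∃ λ c → ∀ y → y ≢ u → adj H x y ≡ c
    homogeneous x ¬x≢u with decidable-stable (x ≟ u) ¬x≢u
    ... | refl = c , uniform

data Split (n p : ℕ) : Fin (n + p) → Set where
  old : (w : Fin n) → Split n p (w ↑ˡ p)
  new : (j : Fin p) → Split n p (n ↑ʳ j)

split : ∀ n p (x : Fin (n + p)) → Split n p x
split n p x with splitAt n x | join-splitAt n p x
... | inj₁ w | refl = old w
... | inj₂ j | refl = new j

module _ {n p} (G : Graph n) (H : Graph (n + p)) (ext : IsExtension p H G) where

  signature : Fin n → Fin p → Bool
  signature u j = adj H (u ↑ˡ p) (n ↑ʳ j)

  adj-old-uniform : ∀ {b u} → Uniform G b u →
    ∀ w → w ↑ˡ p ≢ u ↑ˡ p → adj H (u ↑ˡ p) (w ↑ˡ p) ≡ b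
  adj-old-uniform uniform w w≢u = trans (ext _ w) (uniform w (w≢u ∘ cong (_↑ˡ p)))

  signature-injective : IsPrime H → ∀ {b u v} → Uniform G b u → Uniform G b v →
    signature u ≗ signature v → u ≡ v
  signature-injective prime {b} {u} {v} uniformᵤ uniformᵥ same =
    ↑ˡ-injective p u v (prime⇒twins-equal H prime twins)
    where
    twins : ∀ x → x ≢ u ↑ˡ p → x ≢ v ↑ˡ p → adj H x (u ↑ˡ p) ≡ adj H x (v ↑ˡ p)
    twins x x≢u x≢v with split n p x
    ... | old w = begin
      adj H (w ↑ˡ p) (u ↑ˡ p) ≡⟨ Graph.sym H _ _ ⟩
      adj H (u ↑ˡ p) (w ↑ˡ p) ≡⟨ adj-old-uniform uniformᵤ w x≢u ⟩
      b                       ≡⟨ ≡-sym (adj-old-uniform uniformᵥ w x≢v) ⟩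
      adj H (v ↑ˡ p) (w ↑ˡ p) ≡⟨ Graph.sym H _ _ ⟩
      adj H (w ↑ˡ p) (v ↑ˡ p) ∎
      where open ≡-Reasoning
    ... | new j = begin
      adj H (n ↑ʳ j) (u ↑ˡ p) ≡⟨ Graph.sym H _ _ ⟩
      signature u j           ≡⟨ same j ⟩
      signature v j           ≡⟨ Graph.sym H _ _ ⟩
      adj H (n ↑ʳ j) (v ↑ˡ p) ∎
      where open ≡-Reasoning

  signature-nonconstant : IsPrime H → ∀ {b u} → Uniform G b u → ¬ signature u ≗ const b
  signature-nonconstant prime {b} {u} uniform constant = prime⇒¬uniform H prime uniformᴴ
    where
    uniformᴴ : Uniform H b (u ↑ˡ p)
    uniformᴴ y y≢u with split n p y
    ... | old w = adj-old-uniform uniform w y≢u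
    ... | new j = constant j

encode : ∀ {p} → (Fin p → Bool) → Fin (2 ^ p)
encode f = funToFin (Inverse.from 2↔Bool ∘ f)

encode-injective : ∀ {p} (f g : Fin p → Bool) → encode f ≡ encode g → f ≗ g
encode-injective f g f≡g j = begin
  f j                            ≡⟨ strictlyInverseˡ (f j) ⟨
  to (from (f j))                ≡⟨ cong to (finToFun-funToFin (from ∘ f) j) ⟨
  to (finToFun (encode f) j)     ≡⟨ cong (λ i → to (finToFun i j)) f≡g ⟩
  to (finToFun (encode g) j)     ≡⟨ cong to (finToFun-funToFin (from ∘ g) j) ⟩
  to (from (g j))                ≡⟨ strictlyInverseˡ (g j) ⟩
  g j                            ∎
  where open ≡-Reasoning
        open Inverse 2↔Bool

lookup-injective : ∀ {A : Set} {xs : List A} → Unique xs → Injective _≡_ _≡_ (lookup xs)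
lookup-injective (_ ∷ _)    {zero}  {zero}  _ = refl
lookup-injective (x∉ ∷ _)   {zero}  {suc j} e = contradiction e (All.lookup x∉ (∈-lookup j))
lookup-injective (x∉ ∷ _)   {suc i} {zero}  e = contradiction (≡-sym e) (All.lookup x∉ (∈-lookup i))
lookup-injective (_ ∷ uniq) {suc i} {suc j} e = cong suc (lookup-injective uniq e)

injective-avoiding⇒length< : ∀ {A : Set} {k} {xs : List A} → Unique xs →
  (f : A → Fin k) (c : Fin k) →
  (∀ {x y} → x ∈ xs → y ∈ xs → f x ≡ f y → x ≡ y) → (∀ {x} → x ∈ xs → f x ≢ c) →
  length xs < k
injective-avoiding⇒length< {xs = xs} uniq f c injective avoiding = injective⇒≤ f′-injective
  where
  f′ : Fin (suc (length xs)) → Fin _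
  f′ zero    = c
  f′ (suc i) = f (lookup xs i)
  f′-injective : Injective _≡_ _≡_ f′
  f′-injective {zero}  {zero}  _ = refl
  f′-injective {zero}  {suc j} e = contradiction (≡-sym e) (avoiding (∈-lookup j))
  f′-injective {suc i} {zero}  e = contradiction e (avoiding (∈-lookup i))
  f′-injective {suc i} {suc j} e =
    cong suc (lookup-injective uniq (injective (∈-lookup i) (∈-lookup j) e))

uniform-count : ∀ {n p} (G : Graph n) (H : Graph (n + p)) → IsExtension p H G → IsPrime H →
  ∀ b {P : Pred (Fin n) 0ℓ} (P? : Decidable P) → (∀ {u} → P u → Uniform G b u) →
  length (filter P? (allFin n)) < 2 ^ p
uniform-count {n} {p} G H ext prime b P? P⇒uniform =
  injective-avoiding⇒length< (filter⁺ P? (allFin⁺ n))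
    (encode {p} ∘ signature G H ext) (encode {p} (const b))
    (λ u∈ v∈ same → signature-injective G H ext prime (uniform u∈) (uniform v∈)
      (encode-injective _ _ same))
    (λ u∈ same → signature-nonconstant G H ext prime (uniform u∈)
      (encode-injective _ _ same))
  where
  uniform : ∀ {u} → u ∈ filter P? (allFin n) → Uniform G b u
  uniform u∈ = P⇒uniform (proj₂ (∈-filter⁻ P? {xs = allFin n} u∈))

lemma26 : ∀ {n} (G : Graph n) → (numIso G > 0 ⊎ numIsoCompl G > 0) →
    ∀ (p : ℕ) (H : Graph (n + p)) → IsExtension p H G → IsPrime H →
    ⌈log₂ (numIso G ⊔ numIsoCompl G + 1) ⌉ ≤ p
lemma26 G _ p H ext prime = begin
  ⌈log₂ (numIso G ⊔ numIsoCompl G + 1) ⌉ ≤⟨ ⌈log₂⌉-mono-≤ count ⟩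
  ⌈log₂ (2 ^ p) ⌉                         ≡⟨ ⌈log₂2^n⌉≡n p ⟩
  p                                       ∎
  where
  open ≤-Reasoning
  count : numIso G ⊔ numIsoCompl G + 1 ≤ 2 ^ p
  count rewrite +-comm (numIso G ⊔ numIsoCompl G) 1 = ⊔-lub
    (uniform-count G H ext prime false (isIsolated? G) (isolated⇒uniform G))
    (uniform-count G H ext prime true (isIsolatedCompl? G) (isolatedCompl⇒uniform G))
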